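{- Let $k\ge 5$ be an integer and let $H$ be a subgraph of the star $K_{1,\lceil (k-1)/2\rceil}$. Then $$\operatorname{bgr}_k(P_5:H)=\operatorname{bgr}_k(K_{1,3}:H)=\lceil \sqrt{k}\rceil.$$
   Context: All graphs are finite, simple and without isolated vertices (in particular $H$ is non-empty). $P_n$ is the path on $n$ vertices. A $k$-edge-coloring of a graph is a map from its edge set onto $\{1,\dots,k\}$ that is exact, i.e. every one of the $k$ colors is used at least once. An edge-colored graph is rainbow if all its edges have distinct colors and monochromatic if all its edges have the same color. For non-empty bipartite graphs $G,H$ and a positive integer $k$, the bipartite Gallai-Ramsey number $\operatorname{bgr}_k(G:H)$ is the minimum integer $N$ such that for all $n\ge N$, every (exact) $k$-edge-coloring of the complete bipartite graph $K_{n,n}$ contains a rainbow subgraph isomorphic to $G$ or a monochromatic subgraph isomorphic to $H$. -}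

module Defs where

open import Data.Nat using (ℕ; zero; suc; _+_; _*_; _∸_; _≤_; _<_; ⌈_/2⌉)
open import Data.Fin using (Fin; zero; suc; toℕ)
open import Data.Sum using (_⊎_; inj₁; inj₂)
open import Data.Product using (Σ; ∃; ∃-syntax; _×_; _,_)
open import Data.Maybe using (Maybe; just; nothing)
open import Relation.Binary.PropositionalEquality using (_≡_)
open import Relation.Nullary using (¬_)
open import Data.Empty using (⊥)
open import Data.Unit using (⊤)

record Graph : Set₁ where
  field
    V      : ℕ
    E      : Fin V → Fin V → Set
    sym    : ∀ {u w} → E u w → E w u
    irrefl : ∀ {u} → ¬ E u u
open Graph public

NoIsolated : Graph → Set
NoIsolated G = ∀ (u : Fin (V G)) → ∃[ w ] E G u w

SubgraphOf : Graph → Graph → Set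
SubgraphOf G G' = Σ (Fin (V G) → Fin (V G')) λ g →
  (∀ u w → g u ≡ g w → u ≡ w) × (∀ {u w} → E G u w → E G' (g u) (g w))

PathE : ∀ {n} → Fin n → Fin n → Set
PathE i j = (suc (toℕ i) ≡ toℕ j) ⊎ (suc (toℕ j) ≡ toℕ i)

P : ℕ → Graph
P n = record { V = n ; E = PathE ; sym = sym' ; irrefl = irr }
  where
  sym' : ∀ {u w : Fin n} → PathE u w → PathE w u
  sym' (inj₁ x) = inj₂ x
  sym' (inj₂ x) = inj₁ x
  open import Data.Nat.Properties using (1+n≢n)

  irr : ∀ {u : Fin n} → ¬ PathE u u
  irr {u} (inj₁ x) = 1+n≢n x
  irr {u} (inj₂ x) = 1+n≢n x

StarE : ∀ {n} → Fin n → Fin n → Set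
StarE zero    zero    = ⊥
StarE zero    (suc _) = ⊤
StarE (suc _) zero    = ⊤
StarE (suc _) (suc _) = ⊥

Star : ℕ → Graph
Star m = record { V = suc m ; E = StarE ; sym = sym' ; irrefl = irr }
  where
  sym' : ∀ {u w : Fin (suc m)} → StarE u w → StarE w u
  sym' {zero} {suc _} t = t
  sym' {suc _} {zero} t = t
  irr : ∀ {u : Fin (suc m)} → ¬ StarE u u
  irr {zero} ()
  irr {suc _} ()

K13 : Graph
K13 = Star 3

-- Complete bipartite graph K_{n,n}: vertices Fin n ⊎ Fin n (left / right parts),
-- edges are exactly the pairs (left i, right j).
-- An edge-colouring with k colours: c i j = colour of edge {left i, right j}.
Colouring : ℕ → ℕ → Set
Colouring n k = Fin n → Fin n → Fin k

Exact : ∀ {n k} → Colouring n k → Set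
Exact {n} {k} c = ∀ (x : Fin k) → ∃[ i ] ∃[ j ] c i j ≡ x

col : ∀ {n k} → Colouring n k → Fin n ⊎ Fin n → Fin n ⊎ Fin n → Maybe (Fin k)
col c (inj₁ i) (inj₂ j) = just (c i j)
col c (inj₂ j) (inj₁ i) = just (c i j)
col c (inj₁ _) (inj₁ _) = nothing
col c (inj₂ _) (inj₂ _) = nothing

KnnE : ∀ {n} → Fin n ⊎ Fin n → Fin n ⊎ Fin n → Set
KnnE (inj₁ _) (inj₂ _) = ⊤
KnnE (inj₂ _) (inj₁ _) = ⊤
KnnE (inj₁ _) (inj₁ _) = ⊥
KnnE (inj₂ _) (inj₂ _) = ⊥

Embedding : (n : ℕ) (G : Graph) → (Fin (V G) → Fin n ⊎ Fin n) → Set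
Embedding n G f = (∀ u w → f u ≡ f w → u ≡ w) × (∀ {u w} → E G u w → KnnE (f u) (f w))

-- the copy f of G is rainbow: distinct edges of G receive distinct colours
-- (edges are unordered, so (u,w) and (w,u) are the same edge)
Rainbow : ∀ {n k} → Colouring n k → (G : Graph) → (Fin (V G) → Fin n ⊎ Fin n) → Set
Rainbow c G f = ∀ {u w u' w'} → E G u w → E G u' w' →
  col c (f u) (f w) ≡ col c (f u') (f w') →
  (u ≡ u' × w ≡ w') ⊎ (u ≡ w' × w ≡ u')

Monochromatic : ∀ {n k} → Colouring n k → (G : Graph) → (Fin (V G) → Fin n ⊎ Fin n) → Set
Monochromatic {k = k} c G f = ∃[ x ] (∀ {u w} → E G u w → col c (f u) (f w) ≡ just x)

Arrows : (n k : ℕ) → Graph → Graph → Set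
Arrows n k G H = ∀ (c : Colouring n k) → Exact c →
  (∃[ f ] (Embedding n G f × Rainbow c G f)) ⊎
  (∃[ f ] (Embedding n H f × Monochromatic c H f))

-- N = bgr_k(G:H): the least N, among those for which K_{N,N} admits an exact
-- k-edge-colouring (k ≤ N*N), such that Arrows n k G H holds for all n ≥ N.
IsBGR : ℕ → Graph → Graph → ℕ → Set
IsBGR k G H N =
  k ≤ N * N ×
  (∀ n → N ≤ n → Arrows n k G H) ×
  (∀ M → k ≤ M * M → (∀ n → M ≤ n → Arrows n k G H) → N ≤ M)

IsCeilSqrt : ℕ → ℕ → Set
IsCeilSqrt k N = (N ∸ 1) * (N ∸ 1) < k × k ≤ N * N

-- Let c be an exact k-colouring of K_{n,n}, k ≥ 5, with no rainbow K₁,₃ (resp. P₅).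
-- We find a colour α such that every row, or every column, shows at most one colour besides α.
-- Without a rainbow K₁,₃, all rows and columns show at most two colours and any two rows share
-- a colour (else four colours would cover everything). Pairwise intersecting 2-sets either have
-- a common element α or form a triangle, and a row showing a fifth colour rules out the triangle.
-- Without a rainbow P₅, either no line shows three colours (the previous case) or, say, row u
-- does; then forbidden zigzag paths force every cell to carry either the colour of row u in its
-- column or one fixed colour α. Given α, the other colours occupy distinct rows, so n ≥ k − 1,
-- and any row splits into an α-star and a star of its other colour, one of them with
-- ⌈(k − 1)/2⌉ leaves, which contains H. The lower bound ⌈√k⌉ only says that K_{M,M} needs
-- M² ≥ k edges to carry k colours.
module Submission where

open import Defs hiding (sym)
open import Data.Nat using (ℕ; _≤_; _∸_; ⌈_/2⌉)
open import Data.Product using (_×_)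
open import Data.Nat using (zero; suc; _+_; _*_; _<_; z≤n; s≤s)
open import Data.Nat.Properties
  using (≤-refl; ≤-trans; m≤m+n; ≤-pred; <⇒≱; ≮⇒≥; +-suc; +-identityʳ; ⌈n/2⌉≤n; ∸-monoˡ-≤; *-mono-≤)
import Data.Nat.Properties as ℕ
open import Data.Fin using (Fin; zero; suc; toℕ; inject₁; inject≤; fromℕ<)
open import Data.Fin.Properties
  using (_≟_; any?; all?; ¬∀⟶∃¬; injective⇒≤; inject≤-injective; suc-injective)
open import Data.Vec using (Vec; []; _∷_; lookup; map)
open import Data.Vec.Properties using (lookup-map)
open import Data.Vec.Relation.Unary.All using ([]; _∷_)
open import Data.Vec.Relation.Unary.AllPairs using ([]; _∷_; allPairs?)
open import Data.Vec.Relation.Unary.Any using (here; there)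
import Data.Vec.Relation.Unary.Any as Any
open import Data.Vec.Relation.Unary.Any.Properties using (lookup-index)
open import Data.Vec.Relation.Unary.Unique.Propositional using (Unique)
open import Data.Vec.Relation.Unary.Unique.Propositional.Properties using (lookup-injective)
open import Data.Vec.Membership.Propositional using (_∈_; _∉_)
open import Data.Sum using (_⊎_; inj₁; inj₂; swap; [_,_]′)
import Data.Sum as Sum
open import Data.Sum.Properties using (inj₁-injective; inj₂-injective; swap-involutive)
open import Data.Product using (∃; ∃₂; ∃-syntax; Σ; _,_; proj₁; proj₂)
open import Data.Maybe using (just)
open import Data.Maybe.Properties using (just-injective)
open import Data.Empty using (⊥; ⊥-elim)
open import Data.Unit using (tt)
open import Function using (_∘_; id; Injective)
open import Relation.Binary.PropositionalEquality using (_≡_; _≢_; refl; sym; trans; cong; subst)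
open import Relation.Nullary using (¬_; Dec; yes; no)
open import Relation.Nullary.Decidable using (¬?; _×-dec_; decidable-stable)

private variable
  n k m : ℕ

transpose : Colouring n k → Colouring n k
transpose c i j = c j i

transpose-exact : (c : Colouring n k) → Exact c → Exact (transpose c)
transpose-exact c exact x with exact x
... | i , j , cij≡x = j , i , cij≡x

RainbowCopy : Colouring n k → Graph → Set
RainbowCopy {n} c G = ∃[ f ] (Embedding n G f × Rainbow c G f)

MonochromaticCopy : Colouring n k → Graph → Set
MonochromaticCopy {n} c H = ∃[ f ] (Embedding n H f × Monochromatic c H f)

col-swap : (c : Colouring n k) (x y : Fin n ⊎ Fin n) →
           col c (swap x) (swap y) ≡ col (transpose c) x y
col-swap c (inj₁ _) (inj₁ _) = refl
col-swap c (inj₁ _) (inj₂ _) = refl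
col-swap c (inj₂ _) (inj₁ _) = refl
col-swap c (inj₂ _) (inj₂ _) = refl

KnnE-swap : (x y : Fin n ⊎ Fin n) → KnnE x y → KnnE (swap x) (swap y)
KnnE-swap (inj₁ _) (inj₂ _) _ = tt
KnnE-swap (inj₂ _) (inj₁ _) _ = tt

swap-injective : {x y : Fin n ⊎ Fin n} → swap x ≡ swap y → x ≡ y
swap-injective {x = x} {y} eq = trans (sym (swap-involutive x)) (trans (cong swap eq) (swap-involutive y))

embedding-swap : {G : Graph} {f : Fin (V G) → Fin n ⊎ Fin n} → Embedding n G f → Embedding n G (swap ∘ f)
embedding-swap {f = f} (f-inj , f-edge) =
  (λ u w eq → f-inj u w (swap-injective eq)) , λ {u} {w} e → KnnE-swap (f u) (f w) (f-edge e)

module _ (c : Colouring n k) (G : Graph) where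

  rainbowCopy-transpose : RainbowCopy (transpose c) G → RainbowCopy c G
  rainbowCopy-transpose (f , emb , rainbow) = swap ∘ f , embedding-swap {G = G} emb ,
    λ {u} {w} {u′} {w′} e e′ eq →
      rainbow e e′ (trans (sym (col-swap c (f u) (f w))) (trans eq (col-swap c (f u′) (f w′))))

  monochromaticCopy-transpose : MonochromaticCopy (transpose c) G → MonochromaticCopy c G
  monochromaticCopy-transpose (f , emb , γ , mono) = swap ∘ f , embedding-swap {G = G} emb ,
    γ , λ {u} {w} e → trans (col-swap c (f u) (f w)) (mono e)

monochromaticCopy-subgraph : {c : Colouring n k} {G H : Graph} →
  SubgraphOf H G → MonochromaticCopy c G → MonochromaticCopy c H
monochromaticCopy-subgraph (g , g-inj , g-edge) (f , (f-inj , f-edge) , γ , mono) =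
  f ∘ g , ((λ u w eq → g-inj u w (f-inj (g u) (g w) eq)) , λ e → f-edge (g-edge e)) ,
  γ , λ e → mono (g-edge e)

star : Fin n → (Fin m → Fin n) → Fin (suc m) → Fin n ⊎ Fin n
star r h zero    = inj₁ r
star r h (suc s) = inj₂ (h s)

module _ (c : Colouring n k) (r : Fin n) {h : Fin m → Fin n} where

  star-embedding : Injective _≡_ _≡_ h → Embedding n (Star m) (star r h)
  star-embedding h-inj = injective , edge
    where
    injective : ∀ u w → star r h u ≡ star r h w → u ≡ w
    injective zero    zero    _  = refl
    injective zero    (suc _) ()
    injective (suc _) zero    ()
    injective (suc u) (suc w) eq = cong suc (h-inj (inj₂-injective eq))
    edge : ∀ {u w} → E (Star m) u w → KnnE (star r h u) (star r h w)
    edge {zero}  {suc _} _ = tt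
    edge {suc _} {zero}  _ = tt

  star-rainbow : Injective _≡_ _≡_ (c r ∘ h) → Rainbow c (Star m) (star r h)
  star-rainbow ch-inj {zero}  {suc _} {zero}  {suc _} _ _ eq = inj₁ (refl , cong suc (ch-inj (just-injective eq)))
  star-rainbow ch-inj {zero}  {suc _} {suc _} {zero}  _ _ eq = inj₂ (refl , cong suc (ch-inj (just-injective eq)))
  star-rainbow ch-inj {suc _} {zero}  {zero}  {suc _} _ _ eq = inj₂ (cong suc (ch-inj (just-injective eq)) , refl)
  star-rainbow ch-inj {suc _} {zero}  {suc _} {zero}  _ _ eq = inj₁ (cong suc (ch-inj (just-injective eq)) , refl)

  star-monochromatic : ∀ {γ} → (∀ s → c r (h s) ≡ γ) → Monochromatic c (Star m) (star r h)
  star-monochromatic {γ} same = γ , edge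
    where
    edge : ∀ {u w} → E (Star m) u w → col c (star r h u) (star r h w) ≡ just γ
    edge {zero}  {suc w} _ = cong just (same w)
    edge {suc u} {zero}  _ = cong just (same u)

distinct2 : {A : Set} {a b : A} → a ≢ b → Unique (a ∷ b ∷ [])
distinct2 ab = (ab ∷ []) ∷ [] ∷ []

distinct3 : {A : Set} {a b c : A} → a ≢ b → a ≢ c → b ≢ c → Unique (a ∷ b ∷ c ∷ [])
distinct3 ab ac bc = (ab ∷ ac ∷ []) ∷ (bc ∷ []) ∷ [] ∷ []

distinct4 : {A : Set} {a b c d : A} → a ≢ b → a ≢ c → a ≢ d → b ≢ c → b ≢ d → c ≢ d →
            Unique (a ∷ b ∷ c ∷ d ∷ [])
distinct4 ab ac ad bc bd cd = (ab ∷ ac ∷ ad ∷ []) ∷ (bc ∷ bd ∷ []) ∷ (cd ∷ []) ∷ [] ∷ []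

unique? : (xs : Vec (Fin k) m) → Dec (Unique xs)
unique? = allPairs? (λ x y → ¬? (x ≟ y))

data Repetition {A : Set} (a b c d : A) : Set where
  a≡b : a ≡ b → Repetition a b c d
  a≡c : a ≡ c → Repetition a b c d
  a≡d : a ≡ d → Repetition a b c d
  b≡c : b ≡ c → Repetition a b c d
  b≡d : b ≡ d → Repetition a b c d
  c≡d : c ≡ d → Repetition a b c d

repetition : {a b c d : Fin k} → ¬ Unique (a ∷ b ∷ c ∷ d ∷ []) → Repetition a b c d
repetition {a = a} {b} {c} {d} not-distinct
  with a ≟ b | a ≟ c | a ≟ d | b ≟ c | b ≟ d | c ≟ d
... | yes p | _     | _     | _     | _     | _     = a≡b p
... | no _  | yes p | _     | _     | _     | _     = a≡c p
... | no _  | no _  | yes p | _     | _     | _     = a≡d p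
... | no _  | no _  | no _  | yes p | _     | _     = b≡c p
... | no _  | no _  | no _  | no _  | yes p | _     = b≡d p
... | no _  | no _  | no _  | no _  | no _  | yes p = c≡d p
... | no ab | no ac | no ad | no bc | no bd | no cd = ⊥-elim (not-distinct (distinct4 ab ac ad bc bd cd))

head-repeats : {a b c d : Fin k} → ¬ Unique (a ∷ b ∷ c ∷ d ∷ []) → b ≢ c → b ≢ d → c ≢ d →
  a ≡ b ⊎ a ≡ c ⊎ a ≡ d
head-repeats not-distinct b≢c b≢d c≢d with repetition not-distinct
... | a≡b p = inj₁ p
... | a≡c p = inj₂ (inj₁ p)
... | a≡d p = inj₂ (inj₂ p)
... | b≡c p = ⊥-elim (b≢c p)
... | b≡d p = ⊥-elim (b≢d p)
... | c≡d p = ⊥-elim (c≢d p)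

∈-injective⇒≤ : {l : ℕ} {A : Set} (f : Fin l → A) → Injective _≡_ _≡_ f →
                (xs : Vec A m) → (∀ s → f s ∈ xs) → l ≤ m
∈-injective⇒≤ f f-inj xs inside = injective⇒≤ {f = λ s → Any.index (inside s)} λ {s} {t} eq →
  f-inj (trans (lookup-index (inside s)) (trans (cong (lookup xs) eq) (sym (lookup-index (inside t)))))

too-few-colours : m < k → (cs : Vec (Fin k) m) → ¬ (∀ x → x ∈ cs)
too-few-colours m<k cs covered = <⇒≱ m<k (∈-injective⇒≤ id id cs covered)

injection-escapes : {l : ℕ} → m < l → (f : Fin l → Fin k) → Injective _≡_ _≡_ f →
          (cs : Vec (Fin k) m) → ∃ λ s → f s ∉ cs
injection-escapes m<l f f-inj cs with any? (λ s → ¬? (Any.any? (f s ≟_) cs))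
... | yes found = found
... | no none = ⊥-elim (<⇒≱ m<l (∈-injective⇒≤ f f-inj cs λ s →
  decidable-stable (Any.any? (f s ≟_) cs) (λ f-s∉cs → none (s , f-s∉cs))))

fresh-colour : m < k → (cs : Vec (Fin k) m) → ∃ λ x → x ∉ cs
fresh-colour m<k = injection-escapes m<k id id

-- Zigzag copies of P₅

path-edge : {u w : Fin (suc m)} → suc (toℕ u) ≡ toℕ w → ∃ λ e → u ≡ inject₁ e × w ≡ suc e
path-edge {u = zero}  {zero}        ()
path-edge {u = zero}  {suc zero}    refl = zero , refl , refl
path-edge {u = zero}  {suc (suc _)} ()
path-edge {u = suc _} {zero}        ()
path-edge {suc _} {suc u} {suc w} eq with path-edge {u = u} {w} (ℕ.suc-injective eq)
... | e , refl , refl = suc e , refl , refl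

PathEdge : Fin (suc m) → Fin (suc m) → Set
PathEdge {m} u w = ∃ λ (e : Fin m) → (u ≡ inject₁ e × w ≡ suc e) ⊎ (u ≡ suc e × w ≡ inject₁ e)

pathE-edge : {u w : Fin (suc m)} → PathE u w → PathEdge u w
pathE-edge (inj₁ u→w) = let e , p = path-edge u→w in e , inj₁ p
pathE-edge (inj₂ w→u) = let e , (w≡ , u≡) = path-edge w→u in e , inj₂ (u≡ , w≡)

alternate : Fin 5 → Fin 3 ⊎ Fin 2
alternate zero                         = inj₁ zero
alternate (suc zero)                   = inj₂ zero
alternate (suc (suc zero))             = inj₁ (suc zero)
alternate (suc (suc (suc zero)))       = inj₂ (suc zero)
alternate (suc (suc (suc (suc zero)))) = inj₁ (suc (suc zero))

merge : Fin 3 ⊎ Fin 2 → Fin 5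
merge (inj₁ zero)             = zero
merge (inj₂ zero)             = suc zero
merge (inj₁ (suc zero))       = suc (suc zero)
merge (inj₂ (suc zero))       = suc (suc (suc zero))
merge (inj₁ (suc (suc zero))) = suc (suc (suc (suc zero)))

merge-alternate : ∀ v → merge (alternate v) ≡ v
merge-alternate zero                         = refl
merge-alternate (suc zero)                   = refl
merge-alternate (suc (suc zero))             = refl
merge-alternate (suc (suc (suc zero)))       = refl
merge-alternate (suc (suc (suc (suc zero)))) = refl

alternate-injective : Injective _≡_ _≡_ alternate
alternate-injective {u} {w} eq = trans (sym (merge-alternate u)) (trans (cong merge eq) (merge-alternate w))

sum-map-injective : {A B C D : Set} {f : A → C} {g : B → D} →
  Injective _≡_ _≡_ f → Injective _≡_ _≡_ g → Injective _≡_ _≡_ (Sum.map f g)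
sum-map-injective f-inj g-inj {inj₁ _} {inj₁ _} eq = cong inj₁ (f-inj (inj₁-injective eq))
sum-map-injective f-inj g-inj {inj₂ _} {inj₂ _} eq = cong inj₂ (g-inj (inj₂-injective eq))

zigzag : (i₀ j₀ i₁ j₁ i₂ : Fin n) → Fin 5 → Fin n ⊎ Fin n
zigzag i₀ j₀ i₁ j₁ i₂ = Sum.map (lookup (i₀ ∷ i₁ ∷ i₂ ∷ [])) (lookup (j₀ ∷ j₁ ∷ [])) ∘ alternate

zigzagColours : Colouring n k → (i₀ j₀ i₁ j₁ i₂ : Fin n) → Vec (Fin k) 4
zigzagColours c i₀ j₀ i₁ j₁ i₂ = c i₀ j₀ ∷ c i₁ j₀ ∷ c i₁ j₁ ∷ c i₂ j₁ ∷ []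

RainbowZigzag : Colouring n k → Set
RainbowZigzag c = ∃ λ i₀ → ∃ λ j₀ → ∃ λ i₁ → ∃ λ j₁ → ∃ λ i₂ →
  Unique (i₀ ∷ i₁ ∷ i₂ ∷ []) × Unique (j₀ ∷ j₁ ∷ []) × Unique (zigzagColours c i₀ j₀ i₁ j₁ i₂)

rainbowZigzag? : (c : Colouring n k) → Dec (RainbowZigzag c)
rainbowZigzag? c = any? λ i₀ → any? λ j₀ → any? λ i₁ → any? λ j₁ → any? λ i₂ →
  unique? _ ×-dec unique? _ ×-dec unique? (zigzagColours c i₀ j₀ i₁ j₁ i₂)

col-sym : (c : Colouring n k) (x y : Fin n ⊎ Fin n) → col c x y ≡ col c y x
col-sym c (inj₁ _) (inj₁ _) = refl
col-sym c (inj₁ _) (inj₂ _) = refl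
col-sym c (inj₂ _) (inj₁ _) = refl
col-sym c (inj₂ _) (inj₂ _) = refl

KnnE-sym : (x y : Fin n ⊎ Fin n) → KnnE x y → KnnE y x
KnnE-sym (inj₁ _) (inj₂ _) _ = tt
KnnE-sym (inj₂ _) (inj₁ _) _ = tt

module _ (c : Colouring n k) (i₀ j₀ i₁ j₁ i₂ : Fin n) where
  private
    f = zigzag i₀ j₀ i₁ j₁ i₂

  zigzag-crosses : ∀ e → KnnE (f (inject₁ e)) (f (suc e))
  zigzag-crosses zero                   = tt
  zigzag-crosses (suc zero)             = tt
  zigzag-crosses (suc (suc zero))       = tt
  zigzag-crosses (suc (suc (suc zero))) = tt

  zigzag-colour : ∀ e → col c (f (inject₁ e)) (f (suc e)) ≡ just (lookup (zigzagColours c i₀ j₀ i₁ j₁ i₂) e)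
  zigzag-colour zero                   = refl
  zigzag-colour (suc zero)             = refl
  zigzag-colour (suc (suc zero))       = refl
  zigzag-colour (suc (suc (suc zero))) = refl

  zigzag-embedding : Unique (i₀ ∷ i₁ ∷ i₂ ∷ []) → Unique (j₀ ∷ j₁ ∷ []) → Embedding n (P 5) f
  zigzag-embedding rows cols = injective , edge
    where
    injective : ∀ u w → f u ≡ f w → u ≡ w
    injective u w eq = alternate-injective
      (sum-map-injective (lookup-injective rows _ _) (lookup-injective cols _ _) eq)
    edge : ∀ {u w} → PathE u w → KnnE (f u) (f w)
    edge p with pathE-edge p
    ... | e , inj₁ (refl , refl) = zigzag-crosses e
    ... | e , inj₂ (refl , refl) = KnnE-sym (f (inject₁ e)) (f (suc e)) (zigzag-crosses e)

  zigzag-same-edge : Unique (zigzagColours c i₀ j₀ i₁ j₁ i₂) → ∀ e e′ →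
    col c (f (inject₁ e)) (f (suc e)) ≡ col c (f (inject₁ e′)) (f (suc e′)) → e ≡ e′
  zigzag-same-edge distinct e e′ eq = lookup-injective distinct e e′
    (just-injective (trans (sym (zigzag-colour e)) (trans eq (zigzag-colour e′))))

  zigzag-rainbow : Unique (zigzagColours c i₀ j₀ i₁ j₁ i₂) → Rainbow c (P 5) f
  zigzag-rainbow distinct p q eq with pathE-edge p | pathE-edge q
  ... | e , inj₁ (refl , refl) | e′ , inj₁ (refl , refl) =
    let e≡e′ = zigzag-same-edge distinct e e′ eq in inj₁ (cong inject₁ e≡e′ , cong suc e≡e′)
  ... | e , inj₁ (refl , refl) | e′ , inj₂ (refl , refl) =
    let e≡e′ = zigzag-same-edge distinct e e′ (trans eq (col-sym c _ _)) in
    inj₂ (cong inject₁ e≡e′ , cong suc e≡e′)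
  ... | e , inj₂ (refl , refl) | e′ , inj₁ (refl , refl) =
    let e≡e′ = zigzag-same-edge distinct e e′ (trans (col-sym c _ _) eq) in
    inj₂ (cong suc e≡e′ , cong inject₁ e≡e′)
  ... | e , inj₂ (refl , refl) | e′ , inj₂ (refl , refl) =
    let e≡e′ = zigzag-same-edge distinct e e′ (trans (col-sym c _ _) (trans eq (col-sym c _ _))) in
    inj₁ (cong suc e≡e′ , cong inject₁ e≡e′)

rainbowZigzag-copy : (c : Colouring n k) → RainbowZigzag c → RainbowCopy c (P 5)
rainbowZigzag-copy c (i₀ , j₀ , i₁ , j₁ , i₂ , rows , cols , colours) =
  zigzag i₀ j₀ i₁ j₁ i₂ , zigzag-embedding c i₀ j₀ i₁ j₁ i₂ rows cols ,
  zigzag-rainbow c i₀ j₀ i₁ j₁ i₂ colours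

-- Colourings without a rainbow K₁,₃

RainbowClaw : Colouring n k → Set
RainbowClaw c = ∃ λ i → ∃ λ j₁ → ∃ λ j₂ → ∃ λ j₃ → Unique (c i j₁ ∷ c i j₂ ∷ c i j₃ ∷ [])

rainbowClaw? : (c : Colouring n k) → Dec (RainbowClaw c)
rainbowClaw? c = any? λ i → any? λ j₁ → any? λ j₂ → any? λ j₃ → unique? _

lookup-colours-injective : (c : Colouring n k) (i : Fin n) (js : Vec (Fin n) m) →
  Unique (map (c i) js) → Injective _≡_ _≡_ (c i ∘ lookup js)
lookup-colours-injective c i js distinct {s} {t} eq = lookup-injective distinct s t
  (trans (lookup-map s (c i) js) (trans eq (sym (lookup-map t (c i) js))))

rainbowClaw-copy : (c : Colouring n k) → RainbowClaw c → RainbowCopy c K13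
rainbowClaw-copy c (i , j₁ , j₂ , j₃ , distinct) =
  star i (lookup js) , star-embedding c i (colours-inj ∘ cong (c i)) , star-rainbow c i colours-inj
  where
  js = j₁ ∷ j₂ ∷ j₃ ∷ []
  colours-inj = lookup-colours-injective c i js distinct

claw-repeats : {c : Colouring n k} → ¬ RainbowClaw c → ∀ i j₁ j₂ j₃ →
  c i j₁ ≡ c i j₂ ⊎ c i j₁ ≡ c i j₃ ⊎ c i j₂ ≡ c i j₃
claw-repeats {c = c} no-claw i j₁ j₂ j₃ with c i j₁ ≟ c i j₂ | c i j₁ ≟ c i j₃ | c i j₂ ≟ c i j₃
... | yes p | _     | _     = inj₁ p
... | no _  | yes p | _     = inj₂ (inj₁ p)
... | no _  | no _  | yes p = inj₂ (inj₂ p)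
... | no p  | no q  | no r  = ⊥-elim (no-claw (i , j₁ , j₂ , j₃ , distinct3 p q r))

Palette : Colouring n k → Fin n → Fin k → Fin k → Set
Palette c i p q = ∀ j → c i j ≡ p ⊎ c i j ≡ q

OneColourBesides : Colouring n k → Fin k → Set
OneColourBesides c α = ∀ i j j′ → c i j ≢ α → c i j′ ≢ α → c i j ≡ c i j′

oneColourBesides? : (c : Colouring n k) (α : Fin k) →
  OneColourBesides c α ⊎ ∃ λ i → ∃ λ j → ∃ λ j′ → c i j ≢ α × c i j′ ≢ α × c i j ≢ c i j′
oneColourBesides? c α with (any? λ i → any? λ j → any? λ j′ →
  ¬? (c i j ≟ α) ×-dec ¬? (c i j′ ≟ α) ×-dec ¬? (c i j ≟ c i j′))
... | yes witness = inj₂ witness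
... | no none = inj₁ λ i j j′ j≢α j′≢α →
  decidable-stable (c i j ≟ c i j′) λ ne → none (i , j , j′ , j≢α , j′≢α , ne)

triangle-disjoint : {A : Set} {p q x a : A} → p ≢ q → p ≢ x → q ≢ x →
  a ≡ p ⊎ a ≡ q → a ≡ q ⊎ a ≡ x → a ≡ p ⊎ a ≡ x → ⊥
triangle-disjoint p≢q p≢x q≢x (inj₁ refl) (inj₁ refl) _           = p≢q refl
triangle-disjoint p≢q p≢x q≢x (inj₁ refl) (inj₂ refl) _           = p≢x refl
triangle-disjoint p≢q p≢x q≢x (inj₂ refl) _           (inj₁ refl) = p≢q refl
triangle-disjoint p≢q p≢x q≢x (inj₂ refl) _           (inj₂ refl) = q≢x refl

module NoRainbowClaw {c : Colouring n k} (exact : Exact c) (5≤k : 5 ≤ k)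
  (no-row-claw : ¬ RainbowClaw c) (no-column-claw : ¬ RainbowClaw (transpose c)) where

  palette-of-distinct : ∀ i {j₁ j₂} → c i j₁ ≢ c i j₂ → Palette c i (c i j₁) (c i j₂)
  palette-of-distinct i {j₁} {j₂} j₁≢j₂ j with claw-repeats no-row-claw i j₁ j₂ j
  ... | inj₁ e        = ⊥-elim (j₁≢j₂ e)
  ... | inj₂ (inj₁ e) = inj₁ (sym e)
  ... | inj₂ (inj₂ e) = inj₂ (sym e)

  -- the diagonal entry c i i serves as an arbitrary entry of row i
  palette : ∀ i → ∃₂ λ p q → Palette c i p q
  palette i with (any? λ j → ¬? (c i j ≟ c i i))
  ... | yes (j , j≢i) = c i j , c i i , palette-of-distinct i j≢i
  ... | no constant   = c i i , c i i , λ j →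
    inj₁ (decidable-stable (c i j ≟ c i i) λ j≢i → constant (j , j≢i))

  rows-share-colour : ∀ i i′ → ∃₂ λ j j′ → c i j ≡ c i′ j′
  rows-share-colour i i′ with (any? λ j → any? λ j′ → c i j ≟ c i′ j′)
  ... | yes shared = shared
  ... | no disjoint with palette i | palette i′
  ... | p , q , pal | p′ , q′ , pal′ = ⊥-elim (too-few-colours 5≤k (p ∷ q ∷ p′ ∷ q′ ∷ []) covered)
    where
    covered : ∀ x → x ∈ p ∷ q ∷ p′ ∷ q′ ∷ []
    covered x with exact x
    ... | r , s , refl with claw-repeats no-column-claw s i i′ r
    ... | inj₁ same     = ⊥-elim (disjoint (s , s , same))
    ... | inj₂ (inj₁ e) = [ here ∘ trans (sym e) , there ∘ here ∘ trans (sym e) ]′ (pal s)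
    ... | inj₂ (inj₂ e) =
      [ there ∘ there ∘ here ∘ trans (sym e) , there ∘ there ∘ there ∘ here ∘ trans (sym e) ]′ (pal′ s)

  -- A row containing a fifth colour z shows just one other colour, which would have to lie
  -- in all three palettes.
  no-palette-triangle : ∀ {p q x r r₁ r₂} → p ≢ q → p ≢ x → q ≢ x →
    Palette c r p q → Palette c r₁ q x → Palette c r₂ p x → ⊥
  no-palette-triangle {p} {q} {x} {r} {r₁} {r₂} p≢q p≢x q≢x pal pal₁ pal₂
    with fresh-colour (≤-trans (m≤m+n 4 1) 5≤k) (p ∷ q ∷ x ∷ [])
  ... | z , z∉ with exact z
  ... | r′ , s′ , refl with rows-share-colour r′ r | rows-share-colour r′ r₁ | rows-share-colour r′ r₂
  ... | j , _ , e | j₁ , _ , e₁ | j₂ , _ , e₂ =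
    triangle-disjoint p≢q p≢x q≢x (in-palette e pal)
      (subst (λ a → a ≡ q ⊎ a ≡ x) (sym (agrees j₀-not-z j₁-not-z)) (in-palette e₁ pal₁))
      (subst (λ a → a ≡ p ⊎ a ≡ x) (sym (agrees j₀-not-z j₂-not-z)) (in-palette e₂ pal₂))
    where
    in-palette : ∀ {t t′ i a b} → c r′ t ≡ c i t′ → Palette c i a b → c r′ t ≡ a ⊎ c r′ t ≡ b
    in-palette {t′ = t′} eq pal = Sum.map (trans eq) (trans eq) (pal t′)
    not-z : ∀ {t} → c r′ t ≡ p ⊎ c r′ t ≡ q ⊎ c r′ t ≡ x → c r′ t ≢ c r′ s′
    not-z t∈ eq = z∉ (subst (_∈ p ∷ q ∷ x ∷ []) eq ([ here , there ∘ [ here , there ∘ here ]′ ]′ t∈))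
    j₀-not-z = not-z (Sum.map₂ inj₁ (in-palette e pal))
    j₁-not-z = not-z (inj₂ (in-palette e₁ pal₁))
    j₂-not-z = not-z (Sum.map₂ inj₂ (in-palette e₂ pal₂))
    agrees : ∀ {t t′} → c r′ t ≢ c r′ s′ → c r′ t′ ≢ c r′ s′ → c r′ t ≡ c r′ t′
    agrees {t} {t′} t≢z t′≢z with claw-repeats no-row-claw r′ s′ t t′
    ... | inj₁ e        = ⊥-elim (t≢z (sym e))
    ... | inj₂ (inj₁ e) = ⊥-elim (t′≢z (sym e))
    ... | inj₂ (inj₂ e) = e

  second-palette : ∀ {p q r r₁ j j′} → p ≢ q → Palette c r p q →
    c r₁ j ≢ p → c r₁ j′ ≢ p → c r₁ j ≢ c r₁ j′ → ∃ λ x → x ≢ p × x ≢ q × Palette c r₁ q x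
  second-palette {p} {q} {r} {r₁} {j} {j′} p≢q pal a≢p b≢p a≢b with rows-share-colour r r₁
  ... | t , t′ , e with pal t | palette-of-distinct r₁ a≢b t′
  ... | inj₁ ≡p | inj₁ ≡a = ⊥-elim (a≢p (trans (sym ≡a) (trans (sym e) ≡p)))
  ... | inj₁ ≡p | inj₂ ≡b = ⊥-elim (b≢p (trans (sym ≡b) (trans (sym e) ≡p)))
  ... | inj₂ ≡q | inj₁ ≡a = c r₁ j′ , b≢p , (λ b≡q → a≢b (trans a≡q (sym b≡q))) ,
    Sum.map₁ (λ ≡a′ → trans ≡a′ a≡q) ∘ palette-of-distinct r₁ a≢b
    where
    a≡q = trans (sym ≡a) (trans (sym e) ≡q)
  ... | inj₂ ≡q | inj₂ ≡b = c r₁ j , a≢p , (λ a≡q → a≢b (trans a≡q (sym b≡q))) ,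
    Sum.swap ∘ Sum.map₂ (λ ≡b′ → trans ≡b′ b≡q) ∘ palette-of-distinct r₁ a≢b
    where
    b≡q = trans (sym ≡b) (trans (sym e) ≡q)

  besides-one-of : ∀ {p q r} → p ≢ q → Palette c r p q → OneColourBesides c p ⊎ OneColourBesides c q
  besides-one-of {p} {q} p≢q pal with oneColourBesides? c p | oneColourBesides? c q
  ... | inj₁ besides-p | _             = inj₁ besides-p
  ... | inj₂ _         | inj₁ besides-q = inj₂ besides-q
  ... | inj₂ (r₁ , _ , _ , n₁ , n₁′ , ne₁) | inj₂ (r₂ , _ , _ , n₂ , n₂′ , ne₂)
    with second-palette p≢q pal n₁ n₁′ ne₁ | second-palette (p≢q ∘ sym) (Sum.swap ∘ pal) n₂ n₂′ ne₂
       | rows-share-colour r₁ r₂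
  ... | x , x≢p , x≢q , pal₁ | y , y≢q , y≢p , pal₂ | t₁ , t₂ , e with pal₁ t₁ | pal₂ t₂
  ... | inj₁ ≡q | inj₁ ≡p = ⊥-elim (p≢q (trans (sym ≡p) (trans (sym e) ≡q)))
  ... | inj₁ ≡q | inj₂ ≡y = ⊥-elim (y≢q (trans (sym ≡y) (trans (sym e) ≡q)))
  ... | inj₂ ≡x | inj₁ ≡p = ⊥-elim (x≢p (trans (sym ≡x) (trans e ≡p)))
  ... | inj₂ ≡x | inj₂ ≡y = ⊥-elim (no-palette-triangle p≢q (x≢p ∘ sym) (x≢q ∘ sym) pal pal₁
    (Sum.map₂ (λ ≡y′ → trans ≡y′ (trans (sym ≡y) (trans (sym e) ≡x))) ∘ pal₂))

  oneColourBesides : ∃ (OneColourBesides c)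
  oneColourBesides with (any? λ r → any? λ s₁ → any? λ s₂ → ¬? (c r s₁ ≟ c r s₂))
  ... | yes (r , s₁ , s₂ , p≢q) =
    [ (c r s₁ ,_) , (c r s₂ ,_) ]′ (besides-one-of p≢q (palette-of-distinct r p≢q))
  ... | no monochromatic-rows = fromℕ< (≤-trans (s≤s z≤n) 5≤k) , λ i j j′ _ _ →
    decidable-stable (c i j ≟ c i j′) λ ne → monochromatic-rows (i , j , j′ , ne)

-- Colourings without a rainbow P₅

FollowsRow : Colouring n k → Fin n → Fin k → Set
FollowsRow c u α = ∀ i j → c i j ≡ c u j ⊎ c i j ≡ α

followsRow⇒columns : {c : Colouring n k} {u : Fin n} {α : Fin k} →
  FollowsRow c u α → OneColourBesides (transpose c) α
followsRow⇒columns follows j i i′ i≢α i′≢α with follows i j | follows i′ j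
... | inj₂ e  | _       = ⊥-elim (i≢α e)
... | _       | inj₂ e  = ⊥-elim (i′≢α e)
... | inj₁ e  | inj₁ e′ = trans e (sym e′)

two-others : (t : Fin 3) → ∃₂ λ s₁ s₂ → s₁ ≢ t × s₂ ≢ t × s₁ ≢ s₂
two-others zero             = suc zero , suc (suc zero) , (λ ()) , (λ ()) , (λ ())
two-others (suc zero)       = zero , suc (suc zero) , (λ ()) , (λ ()) , (λ ())
two-others (suc (suc zero)) = zero , suc zero , (λ ()) , (λ ()) , (λ ())

module NoRainbowZigzag {c : Colouring n k} (exact : Exact c) (5≤k : 5 ≤ k)
  (no-row-zigzag : ¬ RainbowZigzag c) (no-column-zigzag : ¬ RainbowZigzag (transpose c)) where

  2<k : 2 < k
  2<k = ≤-trans (m≤m+n 3 2) 5≤k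

  3<k : 3 < k
  3<k = ≤-trans (m≤m+n 4 1) 5≤k

  row-zigzag-repeats : ∀ i₀ i₁ i₂ j₀ j₁ → i₀ ≢ i₁ → i₀ ≢ i₂ → i₁ ≢ i₂ → j₀ ≢ j₁ →
    ¬ Unique (c i₀ j₀ ∷ c i₁ j₀ ∷ c i₁ j₁ ∷ c i₂ j₁ ∷ [])
  row-zigzag-repeats i₀ i₁ i₂ j₀ j₁ i₀≢i₁ i₀≢i₂ i₁≢i₂ j₀≢j₁ distinct =
    no-row-zigzag (i₀ , j₀ , i₁ , j₁ , i₂ , distinct3 i₀≢i₁ i₀≢i₂ i₁≢i₂ , distinct2 j₀≢j₁ , distinct)

  column-zigzag-repeats : ∀ u w j₀ j₁ j₂ → u ≢ w → j₀ ≢ j₁ → j₀ ≢ j₂ → j₁ ≢ j₂ →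
    ¬ Unique (c u j₀ ∷ c u j₁ ∷ c w j₁ ∷ c w j₂ ∷ [])
  column-zigzag-repeats u w j₀ j₁ j₂ u≢w j₀≢j₁ j₀≢j₂ j₁≢j₂ distinct =
    no-column-zigzag (j₀ , u , j₁ , w , j₂ , distinct3 j₀≢j₁ j₀≢j₂ j₁≢j₂ , distinct2 u≢w , distinct)

  -- A cell of a fifth colour would extend three sides of the square, possibly via one further
  -- cell, to a rainbow P₅.
  no-rainbow-square : ∀ {r₁ r₂ s₁ s₂} → r₁ ≢ r₂ → s₁ ≢ s₂ →
    ¬ Unique (c r₁ s₁ ∷ c r₁ s₂ ∷ c r₂ s₁ ∷ c r₂ s₂ ∷ [])
  no-rainbow-square {r₁} {r₂} {s₁} {s₂} r₁≢r₂ s₁≢s₂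
    ((A≢B ∷ A≢C ∷ A≢D ∷ []) ∷ (B≢C ∷ B≢D ∷ []) ∷ (C≢D ∷ []) ∷ [] ∷ []) =
    too-few-colours 5≤k square covered
    where
    square = c r₁ s₁ ∷ c r₁ s₂ ∷ c r₂ s₁ ∷ c r₂ s₂ ∷ []
    A∈ B∈ C∈ D∈ : _ ∈ square
    A∈ = here refl
    B∈ = there (here refl)
    C∈ = there (there (here refl))
    D∈ = there (there (there (here refl)))
    via : ∀ {x a} → a ∈ square → x ≡ a → x ∈ square
    via a∈ x≡a = subst (_∈ square) (sym x≡a) a∈
    one-of : ∀ {x a b d} → a ∈ square → b ∈ square → d ∈ square → x ≡ a ⊎ x ≡ b ⊎ x ≡ d → x ∈ square
    one-of a∈ b∈ d∈ = [ via a∈ , [ via b∈ , via d∈ ]′ ]′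
    off-square : ∀ r s → r ≢ r₁ → r ≢ r₂ → s ≢ s₁ → s ≢ s₂ → c r s ∈ square
    off-square r s r≢r₁ r≢r₂ s≢s₁ s≢s₂
      with head-repeats (row-zigzag-repeats r r₁ r₂ s₁ s₂ r≢r₁ r≢r₂ r₁≢r₂ s₁≢s₂) A≢B A≢D B≢D
         | head-repeats (row-zigzag-repeats r r₂ r₁ s₁ s₂ r≢r₂ r≢r₁ (r₁≢r₂ ∘ sym) s₁≢s₂)
             C≢D (B≢C ∘ sym) (B≢D ∘ sym)
    ... | inj₁ ≡A | inj₁ ≡C = ⊥-elim (A≢C (trans (sym ≡A) ≡C))
    ... | inj₁ ≡A | inj₂ (inj₁ ≡D) = ⊥-elim (A≢D (trans (sym ≡A) ≡D))
    ... | inj₁ ≡A | inj₂ (inj₂ ≡B) = ⊥-elim (A≢B (trans (sym ≡A) ≡B))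
    ... | inj₂ (inj₁ ≡B) | _ = one-of (via B∈ ≡B) C∈ D∈
      (head-repeats (column-zigzag-repeats r r₂ s s₁ s₂ r≢r₂ s≢s₁ s≢s₂ s₁≢s₂)
        (λ q → B≢C (trans (sym ≡B) q)) (λ q → B≢D (trans (sym ≡B) q)) C≢D)
    ... | inj₂ (inj₂ ≡D) | _ = one-of (via D∈ ≡D) A∈ B∈
      (head-repeats (column-zigzag-repeats r r₁ s s₁ s₂ r≢r₁ s≢s₁ s≢s₂ s₁≢s₂)
        (λ q → A≢D (sym (trans (sym ≡D) q))) (λ q → B≢D (sym (trans (sym ≡D) q))) A≢B)
    entry : ∀ r s → c r s ∈ square
    entry r s with r ≟ r₁ | r ≟ r₂ | s ≟ s₁ | s ≟ s₂
    ... | yes refl | _        | yes refl | _        = A∈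
    ... | yes refl | _        | no _     | yes refl = B∈
    ... | yes refl | _        | no s≢s₁  | no s≢s₂  = one-of A∈ C∈ D∈
      (head-repeats (column-zigzag-repeats r₁ r₂ s s₁ s₂ r₁≢r₂ s≢s₁ s≢s₂ s₁≢s₂) A≢C A≢D C≢D)
    ... | no _     | yes refl | yes refl | _        = C∈
    ... | no _     | yes refl | no _     | yes refl = D∈
    ... | no _     | yes refl | no s≢s₁  | no s≢s₂  = one-of C∈ A∈ B∈
      (head-repeats (column-zigzag-repeats r₂ r₁ s s₁ s₂ (r₁≢r₂ ∘ sym) s≢s₁ s≢s₂ s₁≢s₂)
        (A≢C ∘ sym) (B≢C ∘ sym) A≢B)
    ... | no r≢r₁  | no r≢r₂  | yes refl | _        = one-of A∈ B∈ D∈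
      (head-repeats (row-zigzag-repeats r r₁ r₂ s₁ s₂ r≢r₁ r≢r₂ r₁≢r₂ s₁≢s₂) A≢B A≢D B≢D)
    ... | no r≢r₁  | no r≢r₂  | no _     | yes refl = one-of B∈ A∈ C∈
      (head-repeats (row-zigzag-repeats r r₁ r₂ s₂ s₁ r≢r₁ r≢r₂ r₁≢r₂ (s₁≢s₂ ∘ sym)) (A≢B ∘ sym) B≢C A≢C)
    ... | no r≢r₁  | no r≢r₂  | no s≢s₁  | no s≢s₂  = off-square r s r≢r₁ r≢r₂ s≢s₁ s≢s₂
    covered : ∀ x → x ∈ square
    covered x with exact x
    ... | r , s , refl = entry r s

  module EveryColour (u : Fin n) (row-sees : ∀ x → ∃ λ j → c u j ≡ x) where

    column-avoiding : ∀ {m} → m < k → (cs : Vec (Fin k) m) → ∃ λ j → c u j ∉ cs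
    column-avoiding m<k cs with fresh-colour m<k cs
    ... | x , x∉ with row-sees x
    ... | j , refl = j , x∉

    deviating-row : ∀ {w z₀ z} → c w z₀ ≢ c u z₀ → c w z ≢ c w z₀ →
      c w z ≡ c u z₀ × (c u z ≡ c u z₀ ⊎ c u z ≡ c w z₀)
    deviating-row {w} {z₀} {z} dev wz≢wz₀ with column-avoiding 5≤k (c u z ∷ c w z ∷ c w z₀ ∷ c u z₀ ∷ [])
    ... | y′ , y′∉ = w-z , u-z
      where
      u≢w : u ≢ w
      u≢w refl = dev refl
      y′≢z : y′ ≢ z
      y′≢z q = y′∉ (here (cong (c u) q))
      y′≢z₀ : y′ ≢ z₀
      y′≢z₀ q = y′∉ (there (there (there (here (cong (c u) q)))))
      z≢z₀ : z ≢ z₀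
      z≢z₀ q = wz≢wz₀ (cong (c w) q)
      w-z : c w z ≡ c u z₀
      w-z = decidable-stable (c w z ≟ c u z₀) λ ne →
        column-zigzag-repeats u w y′ z₀ z u≢w y′≢z₀ y′≢z (z≢z₀ ∘ sym)
          (distinct4 (λ q → y′∉ (there (there (there (here q)))))
                     (λ q → y′∉ (there (there (here q))))
                     (λ q → y′∉ (there (here q)))
                     (dev ∘ sym) (ne ∘ sym) (wz≢wz₀ ∘ sym))
      u-z : c u z ≡ c u z₀ ⊎ c u z ≡ c w z₀
      u-z with c u z ≟ c u z₀ | c u z ≟ c w z₀
      ... | yes p | _     = inj₁ p
      ... | no _  | yes p = inj₂ p
      ... | no p  | no q  = ⊥-elim (column-zigzag-repeats u w y′ z z₀ u≢w y′≢z y′≢z₀ z≢z₀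
        (distinct4 (λ e → y′∉ (here e)) (λ e → y′∉ (there (here e))) (λ e → y′∉ (there (there (here e))))
                   (λ e → p (trans e w-z)) q wz≢wz₀))

    deviating-row-constant : ∀ {w z₀} → c w z₀ ≢ c u z₀ → ∀ z → c w z ≡ c w z₀
    deviating-row-constant {w} {z₀} dev z with column-avoiding 2<k (c u z₀ ∷ c w z₀ ∷ [])
    ... | y₁ , y₁∉ = decidable-stable (c w z ≟ c w z₀) λ wz≢wz₀ →
      y₁∉ (here (trans (sym (proj₁ (deviating-row dev₁ (λ q → wz≢wz₀ (trans q w-y₁)))))
                       (proj₁ (deviating-row dev wz≢wz₀))))
      where
      w-y₁ : c w y₁ ≡ c w z₀
      w-y₁ = decidable-stable (c w y₁ ≟ c w z₀) λ ne →
        [ y₁∉ ∘ here , y₁∉ ∘ there ∘ here ]′ (proj₂ (deviating-row dev ne))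
      dev₁ : c w y₁ ≢ c u y₁
      dev₁ q = y₁∉ (there (here (trans (sym q) w-y₁)))

    -- Both deviating rows are constant, so a zigzag through row u between them is rainbow.
    same-deviation : ∀ {w z₀ i j} → c w z₀ ≢ c u z₀ → c i j ≢ c u j → c i j ≡ c w z₀
    same-deviation {w} {z₀} {i} {j} dev devi = decidable-stable (c i j ≟ c w z₀) λ ij≢wz₀ →
      let y₁ , y₁∉ = column-avoiding 2<k (c w z₀ ∷ c i j ∷ [])
          y₂ , y₂∉ = column-avoiding 3<k (c w z₀ ∷ c i j ∷ c u y₁ ∷ [])
          w-y₁ = deviating-row-constant dev y₁
          i-y₂ = deviating-row-constant devi y₂
      in row-zigzag-repeats w u i y₁ y₂
           (λ { refl → dev refl })
           (λ { refl → ij≢wz₀ (deviating-row-constant dev j) })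
           (λ { refl → devi refl })
           (λ q → y₂∉ (there (there (here (cong (c u) (sym q))))))
           (distinct4 (λ q → y₁∉ (here (trans (sym q) w-y₁)))
                      (λ q → y₂∉ (here (trans (sym q) w-y₁)))
                      (λ q → ij≢wz₀ (trans (sym i-y₂) (trans (sym q) w-y₁)))
                      (λ q → y₂∉ (there (there (here (sym q)))))
                      (λ q → y₁∉ (there (here (trans q i-y₂))))
                      (λ q → y₂∉ (there (here (trans q i-y₂)))))

    followsRow : ∃ (FollowsRow c u)
    followsRow with (any? λ w → any? λ z₀ → ¬? (c w z₀ ≟ c u z₀))
    ... | yes (w , z₀ , dev) = c w z₀ , follows
      where
      follows : FollowsRow c u (c w z₀)
      follows i j with c i j ≟ c u j
      ... | yes same = inj₁ same
      ... | no devi  = inj₂ (same-deviation dev devi)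
    ... | no none = c u u , λ i j →
      inj₁ (decidable-stable (c i j ≟ c u j) λ devi → none (i , j , devi))

  module RainbowRow (u : Fin n) (y : Fin 3 → Fin n) (a-inj : Injective _≡_ _≡_ (c u ∘ y)) where

    a : Fin 3 → Fin k
    a = c u ∘ y

    y-inj : Injective _≡_ _≡_ y
    y-inj = a-inj ∘ cong (c u)

    other-claw-column : ∀ s j → ∃ λ t → t ≢ s × y t ≢ j
    other-claw-column s j with two-others s
    ... | s₁ , s₂ , s₁≢s , s₂≢s , s₁≢s₂ with y s₁ ≟ j
    ...   | no y₁≢j  = s₁ , s₁≢s , y₁≢j
    ...   | yes y₁≡j = s₂ , s₂≢s , λ y₂≡j → s₁≢s₂ (y-inj (trans y₁≡j (sym y₂≡j)))

    module MissingColour (d : Fin k) (d∉row : ∀ j → c u j ≢ d) (w : Fin n) where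

      u≢w : ∀ {z} → c w z ≡ d → u ≢ w
      u≢w w-z refl = d∉row _ w-z

      module _ {z t} (w-z : c w z ≡ d) (w-yt≢d : c w (y t) ≢ d) where
        private
          yt≢z : y t ≢ z
          yt≢z eq = w-yt≢d (trans (cong (c w) eq) w-z)
          not-d : ∀ {j x} → c u j ≡ x → x ≡ c w z → ⊥
          not-d eq x≡ = d∉row _ (trans eq (trans x≡ w-z))

          forced-by-u : ∀ s → s ≢ t → y s ≢ z → a s ≢ c w (y t) → c u z ≢ c w (y t) → a s ≡ c u z
          forced-by-u s s≢t ys≢z as≢w-yt uz≢w-yt with repetition
            (column-zigzag-repeats u w (y s) z (y t) (u≢w w-z) ys≢z (s≢t ∘ y-inj) (yt≢z ∘ sym))
          ... | a≡b p = p
          ... | a≡c p = ⊥-elim (not-d p refl)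
          ... | a≡d p = ⊥-elim (as≢w-yt p)
          ... | b≡c p = ⊥-elim (not-d p refl)
          ... | b≡d p = ⊥-elim (uz≢w-yt p)
          ... | c≡d p = ⊥-elim (w-yt≢d (trans (sym p) w-z))

          forced-by-w : ∀ s → s ≢ t → y s ≢ z → a t ≢ c w (y t) → a s ≡ c w (y t)
          forced-by-w s s≢t ys≢z at≢w-yt with repetition
            (column-zigzag-repeats u w (y s) (y t) z (u≢w w-z) (s≢t ∘ y-inj) ys≢z yt≢z)
          ... | a≡b p = ⊥-elim (s≢t (a-inj p))
          ... | a≡c p = p
          ... | a≡d p = ⊥-elim (not-d p refl)
          ... | b≡c p = ⊥-elim (at≢w-yt p)
          ... | b≡d p = ⊥-elim (not-d p refl)
          ... | c≡d p = ⊥-elim (w-yt≢d (trans p w-z))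

          square : c u z ≢ a t → c u z ≡ c w (y t) ⊎ a t ≡ c w (y t)
          square uz≢at with repetition (no-rainbow-square (u≢w w-z) (yt≢z ∘ sym))
          ... | a≡b p = ⊥-elim (uz≢at p)
          ... | a≡c p = ⊥-elim (not-d p refl)
          ... | a≡d p = inj₁ p
          ... | b≡c p = ⊥-elim (not-d p refl)
          ... | b≡d p = inj₂ p
          ... | c≡d p = ⊥-elim (w-yt≢d (trans (sym p) w-z))

          others-collide : ∀ v → (∀ s → s ≢ t → y s ≢ z → a s ≡ v) → c u z ≡ v → ⊥
          others-collide v forced uz≡v with two-others t
          ... | s₁ , s₂ , s₁≢t , s₂≢t , s₁≢s₂ =
            s₁≢s₂ (a-inj (trans (coloured s₁ s₁≢t) (sym (coloured s₂ s₂≢t))))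
            where
            coloured : ∀ s → s ≢ t → a s ≡ v
            coloured s s≢t with y s ≟ z
            ... | yes ys≡z = trans (cong (c u) ys≡z) uz≡v
            ... | no ys≢z  = forced s s≢t ys≢z

        -- The square on rows u, w and columns z, y t leaves two cases; in each, zigzags through
        -- row u force the two other claw columns to the same colour.
        deviation-colour : c u z ≡ a t
        deviation-colour with c u z ≟ a t
        ... | yes uz≡at = uz≡at
        ... | no uz≢at with square uz≢at
        ...   | inj₁ uz≡w-yt = ⊥-elim (others-collide _ forced uz≡w-yt)
          where
          forced : ∀ s → s ≢ t → y s ≢ z → a s ≡ c w (y t)
          forced s s≢t ys≢z = forced-by-w s s≢t ys≢z λ at≡w-yt → uz≢at (trans uz≡w-yt (sym at≡w-yt))
        ...   | inj₂ at≡w-yt = ⊥-elim (others-collide _ forced refl)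
          where
          forced : ∀ s → s ≢ t → y s ≢ z → a s ≡ c u z
          forced s s≢t ys≢z = forced-by-u s s≢t ys≢z
            (λ as≡w-yt → s≢t (a-inj (trans as≡w-yt (sym at≡w-yt))))
            (λ uz≡w-yt → uz≢at (trans uz≡w-yt (sym at≡w-yt)))

        claw-avoids : ∀ s → y s ≢ z
        claw-avoids s ys≡z = yt≢z (trans (cong y (sym s≡t)) ys≡z)
          where
          s≡t = a-inj (trans (cong (c u) ys≡z) deviation-colour)

      claw-coloured-d : ∀ {z₀} → c w z₀ ≡ d → ∀ t → c w (y t) ≡ d
      claw-coloured-d w-z₀ t with c w (y t) ≟ d
      ... | yes w-yt≡d = w-yt≡d
      ... | no w-yt≢d with two-others t
      ... | s , _ , s≢t , _ with c w (y s) ≟ d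
      ...   | no w-ys≢d  =
        ⊥-elim (s≢t (a-inj (trans (sym (deviation-colour w-z₀ w-ys≢d)) (deviation-colour w-z₀ w-yt≢d))))
      ...   | yes w-ys≡d = ⊥-elim (claw-avoids w-ys≡d w-yt≢d s refl)

      no-third-colour : ∀ {z₀} → c w z₀ ≡ d → ∀ i j → c i j ≢ c u j → c i j ≢ d → ⊥
      no-third-colour w-z₀ i j ≢uj ≢d
        with injection-escapes ≤-refl a a-inj (c i j ∷ c u j ∷ [])
      ... | s , as∉ = through (i ≟ u) (i ≟ w)
        where
        ys≢j : y s ≢ j
        ys≢j q = as∉ (there (here (cong (c u) q)))
        claw-d : ∀ t → c w (y t) ≡ d
        claw-d = claw-coloured-d w-z₀
        through : Dec (i ≡ u) → Dec (i ≡ w) → ⊥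
        through (yes refl) _          = ≢uj refl
        through (no i≢u)   (yes refl) =
          let t , t≢s , yt≢j = other-claw-column s j
          in column-zigzag-repeats w u (y t) j (y s) (u≢w w-z₀ ∘ sym) yt≢j (t≢s ∘ y-inj) (ys≢j ∘ sym)
               (distinct4 (λ q → ≢d (trans (sym q) (claw-d t)))
                          (λ q → d∉row j (trans (sym q) (claw-d t)))
                          (λ q → d∉row (y s) (trans (sym q) (claw-d t)))
                          ≢uj (λ q → as∉ (here (sym q))) (λ q → as∉ (there (here (sym q)))))
        through (no i≢u)   (no i≢w)   =
          row-zigzag-repeats w u i (y s) j (u≢w w-z₀ ∘ sym) (i≢w ∘ sym) (i≢u ∘ sym) ys≢j
            (distinct4 (λ q → d∉row (y s) (trans (sym q) (claw-d s)))
                       (λ q → d∉row j (trans (sym q) (claw-d s)))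
                       (λ q → ≢d (trans (sym q) (claw-d s)))
                       (λ q → as∉ (there (here q))) (λ q → as∉ (here q)) (≢uj ∘ sym))

      followsRow : ∀ {z₀} → c w z₀ ≡ d → FollowsRow c u d
      followsRow w-z₀ i j with c i j ≟ c u j | c i j ≟ d
      ... | yes ≡uj | _      = inj₁ ≡uj
      ... | no _    | yes ≡d = inj₂ ≡d
      ... | no ≢uj  | no ≢d  = ⊥-elim (no-third-colour w-z₀ i j ≢uj ≢d)


    followsRow : ∃ (FollowsRow c u)
    followsRow with (any? λ d → all? λ j → ¬? (c u j ≟ d))
    ... | yes (d , d∉row) with exact d
    ...   | w , z₀ , w-z₀ = d , MissingColour.followsRow d d∉row w w-z₀
    followsRow | no every-colour-seen = EveryColour.followsRow u row-sees
      where
      row-sees : ∀ x → ∃ λ j → c u j ≡ x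
      row-sees x with ¬∀⟶∃¬ n (λ j → c u j ≢ x) (λ j → ¬? (c u j ≟ x)) (λ ∉ → every-colour-seen (x , ∉))
      ... | j , ¬¬seen = j , decidable-stable (c u j ≟ x) ¬¬seen

  claw⇒columns : RainbowClaw c → ∃ (OneColourBesides (transpose c))
  claw⇒columns (u , j₁ , j₂ , j₃ , distinct) =
    let α , follows = RainbowRow.followsRow u (lookup js) (lookup-colours-injective c u js distinct)
    in α , followsRow⇒columns follows
    where
    js = j₁ ∷ j₂ ∷ j₃ ∷ []

zigzag-free⇒besides : {c : Colouring n k} → Exact c → 5 ≤ k →
  ¬ RainbowZigzag c → ¬ RainbowZigzag (transpose c) →
  ∃ (OneColourBesides c) ⊎ ∃ (OneColourBesides (transpose c))
zigzag-free⇒besides {c = c} exact 5≤k no-row no-column with rainbowClaw? c | rainbowClaw? (transpose c)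
... | yes claw | _        = inj₂ (NoRainbowZigzag.claw⇒columns exact 5≤k no-row no-column claw)
... | no _     | yes claw =
  inj₁ (NoRainbowZigzag.claw⇒columns (transpose-exact c exact) 5≤k no-column no-row claw)
... | no n₁    | no n₂    = inj₁ (NoRainbowClaw.oneColourBesides exact 5≤k n₁ n₂)

-- Large monochromatic stars

Many : ℕ → (Fin n → Set) → Set
Many {n} m P = Σ (Fin m → Fin n) λ f → Injective _≡_ _≡_ f × (∀ s → P (f s))

many-map : {P Q : Fin n → Set} → (∀ {j} → P j → Q j) → Many m P → Many m Q
many-map P⇒Q (f , f-inj , f-P) = f , f-inj , P⇒Q ∘ f-P

many-≤ : {P : Fin n → Set} {m′ : ℕ} → m′ ≤ m → Many m P → Many m′ P
many-≤ m′≤m (f , f-inj , f-P) =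
  (λ s → f (inject≤ s m′≤m)) , (λ eq → inject≤-injective m′≤m m′≤m _ _ (f-inj eq)) , λ s → f-P _

module _ {P : Fin (suc n) → Set} where

  many-suc : Many m (P ∘ suc) → Many m P
  many-suc (f , f-inj , f-P) = suc ∘ f , f-inj ∘ suc-injective , f-P

  many-cons : P zero → Many m (P ∘ suc) → Many (suc m) P
  many-cons P0 (f , f-inj , f-P) = f′ , f′-inj , f′-P
    where
    f′ : Fin (suc _) → Fin (suc n)
    f′ zero    = zero
    f′ (suc s) = suc (f s)
    f′-inj : Injective _≡_ _≡_ f′
    f′-inj {zero}  {zero}  _  = refl
    f′-inj {zero}  {suc _} ()
    f′-inj {suc _} {zero}  ()
    f′-inj {suc _} {suc _} eq = cong suc (f-inj (suc-injective eq))
    f′-P : ∀ s → P (f′ s)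
    f′-P zero    = P0
    f′-P (suc s) = f-P s

partition : (P : Fin n → Set) → (∀ j → Dec (P j)) →
  ∃₂ λ a b → a + b ≡ n × Many a P × Many b (¬_ ∘ P)
partition {zero}  P P? = 0 , 0 , refl , none {Q = P} , none {Q = ¬_ ∘ P}
  where
  none : ∀ {Q : Fin 0 → Set} → Many 0 Q
  none = (λ ()) , (λ { {()} }) , (λ ())
partition {suc n} P P? with partition (P ∘ suc) (P? ∘ suc) | P? zero
... | a , b , a+b≡n , as , bs | yes P0 =
  suc a , b , cong suc a+b≡n , many-cons {P = P} P0 as , many-suc {P = ¬_ ∘ P} bs
... | a , b , a+b≡n , as , bs | no ¬P0 =
  a , suc b , trans (+-suc a b) (cong suc a+b≡n) , many-suc {P = P} as , many-cons {P = ¬_ ∘ P} ¬P0 bs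

⌈/2⌉≤-either : ∀ x a b → x ≤ a + b → ⌈ x /2⌉ ≤ a ⊎ ⌈ x /2⌉ ≤ b
⌈/2⌉≤-either x zero b x≤b = inj₂ (≤-trans (⌈n/2⌉≤n x) x≤b)
⌈/2⌉≤-either x (suc a) zero x≤a = inj₁ (≤-trans (⌈n/2⌉≤n x) (subst (x ≤_) (+-identityʳ (suc a)) x≤a))
⌈/2⌉≤-either zero (suc a) (suc b) _ = inj₁ z≤n
⌈/2⌉≤-either (suc zero) (suc a) (suc b) _ = inj₁ (s≤s z≤n)
⌈/2⌉≤-either (suc (suc x)) (suc a) (suc b) (s≤s x<a+1+b) =
  Sum.map s≤s s≤s (⌈/2⌉≤-either x a b (≤-pred (subst (suc x ≤_) (+-suc a b) x<a+1+b)))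

monochromaticCopy-star : (c : Colouring n k) (r : Fin n) {γ : Fin k} →
  Many m (λ j → c r j ≡ γ) → MonochromaticCopy c (Star m)
monochromaticCopy-star c r (f , f-inj , f-γ) =
  star r f , star-embedding c r f-inj , star-monochromatic c r f-γ

palette-star : ∀ {x} (c : Colouring n k) (r : Fin n) {α β : Fin k} →
  Palette c r α β → x ≤ n → MonochromaticCopy c (Star ⌈ x /2⌉)
palette-star {x = x} c r {α} {β} pal x≤n with partition (λ j → c r j ≡ α) (λ j → c r j ≟ α)
... | a , b , a+b≡n , αs , others with ⌈/2⌉≤-either x a b (subst (x ≤_) (sym a+b≡n) x≤n)
...   | inj₁ ≤a = monochromaticCopy-star c r (many-≤ {P = λ j → c r j ≡ α} ≤a αs)
...   | inj₂ ≤b = monochromaticCopy-star c r (many-≤ {P = λ j → c r j ≡ β} ≤b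
  (many-map {P = λ j → c r j ≢ α} (λ {j} ≢α → [ ⊥-elim ∘ ≢α , id ]′ (pal j)) others))

besides-palette : {c : Colouring n k} {α : Fin k} → OneColourBesides c α → ∀ i → ∃ λ β → Palette c i α β
besides-palette {c = c} {α} besides i with (any? λ j → ¬? (c i j ≟ α))
... | no none = α , λ j → inj₁ (decidable-stable (c i j ≟ α) λ j≢α → none (j , j≢α))
... | yes (j , j≢α) = c i j , palette
  where
  palette : Palette c i α (c i j)
  palette j′ with c i j′ ≟ α
  ... | yes j′≡α = inj₁ j′≡α
  ... | no j′≢α  = inj₂ (besides i j′ j j′≢α j≢α)

colours≤1+rows : {c : Colouring n k} {α : Fin k} → Exact c → OneColourBesides c α → k ≤ suc n
colours≤1+rows {n} {k} {c} {α} exact besides = injective⇒≤ {f = slot} slot-injective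
  where
  slot : Fin k → Fin (suc n)
  slot x with x ≟ α
  ... | yes _ = zero
  ... | no _  = suc (proj₁ (exact x))
  slot-injective : Injective _≡_ _≡_ slot
  slot-injective {x} {y} eq with x ≟ α | y ≟ α
  ... | yes x≡α | yes y≡α = trans x≡α (sym y≡α)
  ... | no x≢α  | no y≢α with exact x | exact y | suc-injective eq
  ...   | i , jx , refl | .i , jy , refl | refl = besides i jx jy x≢α y≢α

besides⇒star : {c : Colouring n k} {α : Fin k} → Exact c → OneColourBesides c α →
  MonochromaticCopy c (Star ⌈ k ∸ 1 /2⌉)
besides⇒star {c = c} {α} exact besides with exact α
... | r , _ = palette-star c r (proj₂ (besides-palette besides r))
  (∸-monoˡ-≤ 1 (colours≤1+rows exact besides))

either-besides⇒star : {c : Colouring n k} → Exact c →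
  ∃ (OneColourBesides c) ⊎ ∃ (OneColourBesides (transpose c)) → MonochromaticCopy c (Star ⌈ k ∸ 1 /2⌉)
either-besides⇒star exact (inj₁ (_ , besides)) = besides⇒star exact besides
either-besides⇒star {c = c} exact (inj₂ (_ , besides)) =
  monochromaticCopy-transpose c (Star _) (besides⇒star (transpose-exact c exact) besides)

arrows-P5 : ∀ {H} → 5 ≤ k → SubgraphOf H (Star ⌈ k ∸ 1 /2⌉) → Arrows n k (P 5) H
arrows-P5 {k = k} {H = H} 5≤k H⊆star c exact with rainbowZigzag? c | rainbowZigzag? (transpose c)
... | yes zz | _      = inj₁ (rainbowZigzag-copy c zz)
... | no _   | yes zz = inj₁ (rainbowCopy-transpose c (P 5) (rainbowZigzag-copy (transpose c) zz))
... | no n₁  | no n₂  = inj₂ (monochromaticCopy-subgraph {G = Star ⌈ k ∸ 1 /2⌉} {H} H⊆star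
  (either-besides⇒star exact (zigzag-free⇒besides exact 5≤k n₁ n₂)))

arrows-K13 : ∀ {H} → 5 ≤ k → SubgraphOf H (Star ⌈ k ∸ 1 /2⌉) → Arrows n k K13 H
arrows-K13 {k = k} {H = H} 5≤k H⊆star c exact with rainbowClaw? c | rainbowClaw? (transpose c)
... | yes claw | _        = inj₁ (rainbowClaw-copy c claw)
... | no _     | yes claw = inj₁ (rainbowCopy-transpose c K13 (rainbowClaw-copy (transpose c) claw))
... | no n₁    | no n₂    = inj₂ (monochromaticCopy-subgraph {G = Star ⌈ k ∸ 1 /2⌉} {H} H⊆star
  (besides⇒star exact (proj₂ (NoRainbowClaw.oneColourBesides exact 5≤k n₁ n₂))))

ceilSqrt-least : ∀ {N M} → IsCeilSqrt k N → k ≤ M * M → N ≤ M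
ceilSqrt-least (below , _) k≤M² = ≮⇒≥ λ M<N →
  let M≤N-1 = ∸-monoˡ-≤ 1 M<N in <⇒≱ below (≤-trans k≤M² (*-mono-≤ M≤N-1 M≤N-1))

ceilSqrt-isBGR : ∀ {G H N} → IsCeilSqrt k N → (∀ n → Arrows n k G H) → IsBGR k G H N
ceilSqrt-isBGR ceil arrows = proj₂ ceil , (λ n _ → arrows n) , λ M k≤M² _ → ceilSqrt-least ceil k≤M²

theorem4p4 : ∀ (k : ℕ) → 5 ≤ k → ∀ (H : Graph) → NoIsolated H → 1 ≤ V H →
    SubgraphOf H (Star ⌈ k ∸ 1 /2⌉) → ∀ (N : ℕ) → IsCeilSqrt k N →
    IsBGR k (P 5) H N × IsBGR k K13 H N
theorem4p4 k 5≤k H _ _ H⊆star N ceil =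
  ceilSqrt-isBGR {G = P 5} {H} ceil (λ n → arrows-P5 {n = n} {H = H} 5≤k H⊆star) ,
  ceilSqrt-isBGR {G = K13} {H} ceil (λ n → arrows-K13 {n = n} {H = H} 5≤k H⊆star)
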